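{- For all integers $k,\ell\ge 3$, $\chi_o(\vec{DP_k}[\vec{DP_\ell}])=9$.
   Context: An oriented graph is a finite digraph with no loops, no multiple arcs and no pair of opposite arcs. A homomorphism between oriented graphs is a vertex map sending arcs to arcs. The oriented chromatic number $\chi_o(\vec G)$ is the smallest order of an oriented graph $\vec T$ with a homomorphism $\vec G\to\vec T$. $\vec{DP_k}$ denotes the directed path on $k$ vertices $x_1,\dots,x_k$ with arcs $(x_i,x_{i+1})$, $1\le i<k$. The lexicographic product $\vec G[\vec H]$ has vertex set $V(\vec G)\times V(\vec H)$, and $([u,v],[u',v'])$ is an arc iff either $(u,u')$ is an arc of $\vec G$, or $u=u'$ and $(v,v')$ is an arc of $\vec H$. -}

module Defs where

open import Data.Nat using (ℕ; suc; _<_)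
open import Data.Fin using (Fin; toℕ)
open import Data.Product using (_×_; Σ; ∃; _,_)
open import Data.Sum using (_⊎_)
open import Data.Empty using (⊥)
open import Relation.Nullary using (¬_)
open import Relation.Binary.PropositionalEquality using (_≡_)
open import Level using (0ℓ)

-- A finite digraph on vertex set Fin n given by an arc relation.
-- (A relation cannot express multiple arcs, so "no multiple arcs" is built in.)
record Digraph : Set₁ where
  field
    order : ℕ
    Arc   : Fin order → Fin order → Set

open Digraph public

IsOriented : Digraph → Set
IsOriented G = (∀ u → ¬ Arc G u u) × (∀ u v → Arc G u v → ¬ Arc G v u)

record OrientedGraph : Set₁ where
  field
    graph    : Digraph
    oriented : IsOriented graph

open OrientedGraph public

Hom : Digraph → Digraph → Set
Hom G T = Σ (Fin (order G) → Fin (order T)) λ f →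
            ∀ u v → Arc G u v → Arc T (f u) (f v)

Colourable : Digraph → ℕ → Set₁
Colourable G m = Σ OrientedGraph λ T → (order (graph T) ≡ m) × Hom G (graph T)

OrientedChromaticNumber : Digraph → ℕ → Set₁
OrientedChromaticNumber G c = Colourable G c × (∀ m → m < c → ¬ Colourable G m)

-- Directed path DP_k on vertices x_1..x_k (here indexed 0..k-1), arcs (x_i, x_{i+1}).
DP : ℕ → Digraph
DP k = record { order = k ; Arc = λ i j → suc (toℕ i) ≡ toℕ j }

-- Lexicographic product G[H], vertex set V(G) × V(H) encoded as Fin (|G| * |H|).
open import Data.Fin using (combine; remQuot)
open import Data.Nat using (_*_)
open import Data.Product using (proj₁; proj₂)

Lex : Digraph → Digraph → Digraph
Lex G H = record
  { order = order G * order H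
  ; Arc = λ x y →
      let (u , v)   = remQuot {order G} (order H) x
          (u' , v') = remQuot {order G} (order H) y
      in Arc G u u' ⊎ ((u ≡ u') × Arc H v v')
  }

-- The target for the upper bound is the lexicographic square of the directed
-- triangle: colour (i , j) by (i mod 3 , j mod 3).  For the lower bound, two
-- vertices joined by a directed path of length one or two must get distinct
-- colours under any homomorphism into an oriented graph, since otherwise the
-- image would contain a loop or a pair of opposite arcs.  The nine vertices
-- (i , j) with i , j < 3 are pairwise joined in this way, so at least nine
-- colours are needed.
module Submission where

open import Defs
open import Data.Nat using (ℕ; zero; suc; _+_; _*_; _≤_; _<_; s≤s)
open import Data.Fin using (Fin; toℕ; combine; remQuot; _↑ˡ_; _≟_)
  renaming (zero to fzero; suc to fsuc)
open import Data.Fin.Properties using (remQuot-combine; combine-remQuot; pigeonhole; <⇒≢)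
open import Data.Product using (∃; Σ; _×_; _,_; uncurry)
  renaming (map to ×-map)
open import Data.Sum using (_⊎_; inj₁; inj₂) renaming (map to ⊎-map)
open import Function using (_∘_)
open import Relation.Nullary using (¬_; yes; no; contradiction)
open import Relation.Binary.PropositionalEquality
  using (_≡_; _≢_; refl; sym; cong; subst; subst₂; module ≡-Reasoning)

Vertex : Digraph → Set
Vertex G = Fin (order G)

Dipath≤2 : (G : Digraph) → Vertex G → Vertex G → Set
Dipath≤2 G x y = Arc G x y ⊎ ∃ λ w → Arc G x w × Arc G w y

Linked : (G : Digraph) → Vertex G → Vertex G → Set
Linked G x y = Dipath≤2 G x y ⊎ Dipath≤2 G y x

oriented⇒¬closed-Dipath≤2 : ∀ {T} → IsOriented T → ∀ {z} → ¬ Dipath≤2 T z z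
oriented⇒¬closed-Dipath≤2 (irr , _)    (inj₁ a)           = irr _ a
oriented⇒¬closed-Dipath≤2 (_ , asym)   (inj₂ (_ , a , b)) = asym _ _ a b

map-Dipath≤2 : ∀ {G T} ((f , _) : Hom G T) → ∀ {x y} →
               Dipath≤2 G x y → Dipath≤2 T (f x) (f y)
map-Dipath≤2 (f , hf) (inj₁ a)           = inj₁ (hf _ _ a)
map-Dipath≤2 (f , hf) (inj₂ (w , a , b)) = inj₂ (f w , hf _ _ a , hf _ _ b)

hom-separates-Linked : ∀ {G T} → IsOriented T → ((f , _) : Hom G T) → ∀ {x y} →
                       Linked G x y → f x ≢ f y
hom-separates-Linked {T = T} oT h@(f , _) {y = y} (inj₁ p) fx≡fy =
  oriented⇒¬closed-Dipath≤2 oT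
    (subst (λ z → Dipath≤2 T z (f y)) fx≡fy (map-Dipath≤2 {T = T} h p))
hom-separates-Linked {T = T} oT h@(f , _) {y = y} (inj₂ p) fx≡fy =
  oriented⇒¬closed-Dipath≤2 oT
    (subst (Dipath≤2 T (f y)) fx≡fy (map-Dipath≤2 {T = T} h p))

OrientedClique : Digraph → ℕ → Set
OrientedClique G n = Σ (Fin n → Vertex G) λ h → ∀ {p q} → p ≢ q → Linked G (h p) (h q)

OrientedClique⇒¬Colourable : ∀ {G n m} → OrientedClique G n → m < n → ¬ Colourable G m
OrientedClique⇒¬Colourable (h , linked) m<n (T , refl , f , hf)
  with p , q , p<q , fhp≡fhq ← pigeonhole m<n (f ∘ h)
  = hom-separates-Linked (oriented T) (f , hf) (linked (<⇒≢ p<q)) fhp≡fhq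

module _ {G H : Digraph} where

  combine-Arc : ∀ {u u' v v'} → Arc G u u' ⊎ (u ≡ u' × Arc H v v') →
                Arc (Lex G H) (combine u v) (combine u' v')
  combine-Arc {u} {u'} {v} {v'} =
    subst₂ LexArc (sym (remQuot-combine {order G} {order H} u v))
                  (sym (remQuot-combine {order G} {order H} u' v'))
    where
    LexArc : Vertex G × Vertex H → Vertex G × Vertex H → Set
    LexArc (u , v) (u' , v') = Arc G u u' ⊎ (u ≡ u' × Arc H v v')

  row-hom : Vertex G → Hom H (Lex G H)
  row-hom u = combine u , λ _ _ a → combine-Arc (inj₂ (refl , a))

  Dipath≤2-across : ∀ {u u'} v v' → Dipath≤2 G u u' →
                    Dipath≤2 (Lex G H) (combine u v) (combine u' v')
  Dipath≤2-across v v' (inj₁ a)           = inj₁ (combine-Arc (inj₁ a))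
  Dipath≤2-across v v' (inj₂ (w , a , b)) =
    inj₂ (combine w v , combine-Arc (inj₁ a) , combine-Arc (inj₁ b))

  Linked-across : ∀ {u u'} v v' → Linked G u u' →
                  Linked (Lex G H) (combine u v) (combine u' v')
  Linked-across v v' = ⊎-map (Dipath≤2-across v v') (Dipath≤2-across v' v)

  Linked-within : ∀ u {v v'} → Linked H v v' →
                  Linked (Lex G H) (combine u v) (combine u v')
  Linked-within u = ⊎-map (map-Dipath≤2 {H} {Lex G H} (row-hom u))
                          (map-Dipath≤2 {H} {Lex G H} (row-hom u))

Lex-oriented : ∀ {G H} → IsOriented G → IsOriented H → IsOriented (Lex G H)
Lex-oriented {G} {H} (irrG , asymG) (irrH , asymH) = irr , asym
  where
  irr : ∀ x → ¬ Arc (Lex G H) x x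
  irr _ (inj₁ a)       = irrG _ a
  irr _ (inj₂ (_ , a)) = irrH _ a

  asym : ∀ x y → Arc (Lex G H) x y → ¬ Arc (Lex G H) y x
  asym _ _ (inj₁ a)       (inj₁ b)       = asymG _ _ a b
  asym _ _ (inj₁ a)       (inj₂ (e , _)) = irrG _ (subst (Arc G _) e a)
  asym _ _ (inj₂ (e , _)) (inj₁ b)       = irrG _ (subst (Arc G _) e b)
  asym _ _ (inj₂ (_ , a)) (inj₂ (_ , b)) = asymH _ _ a b

Lex-hom : ∀ {G G' H H'} → Hom G G' → Hom H H' → Hom (Lex G H) (Lex G' H')
Lex-hom {G} {G'} {H} {H'} (f , hf) (g , hg) =
  uncurry combine ∘ ×-map f g ∘ remQuot {order G} (order H) ,
  λ _ _ → combine-Arc {G'} {H'} ∘ ⊎-map (hf _ _) (×-map (cong f) (hg _ _))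

remQuot-injective : ∀ {m} n {p q : Fin (m * n)} → remQuot {m} n p ≡ remQuot n q → p ≡ q
remQuot-injective {m} n {p} {q} eq = begin
  p                                   ≡⟨ sym (combine-remQuot {m} n p) ⟩
  uncurry combine (remQuot {m} n p)   ≡⟨ cong (uncurry combine) eq ⟩
  uncurry combine (remQuot {m} n q)   ≡⟨ combine-remQuot {m} n q ⟩
  q                                   ∎
  where open ≡-Reasoning

Lex-OrientedClique : ∀ {G H a b} → OrientedClique G a → OrientedClique H b →
                     OrientedClique (Lex G H) (a * b)
Lex-OrientedClique {G} {H} {a} {b} (s , sLinked) (t , tLinked) =
  (λ p → pair (remQuot b p)) ,
  λ p≢q → linked-pairs _ _ (p≢q ∘ remQuot-injective b)
  where
  pair : Fin a × Fin b → Vertex (Lex G H)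
  pair (i , j) = combine (s i) (t j)

  linked-pairs : ∀ x y → x ≢ y → Linked (Lex G H) (pair x) (pair y)
  linked-pairs (i , j) (i' , j') x≢y with i ≟ i'
  ... | no i≢i'  = Linked-across {G} {H} (t j) (t j') (sLinked i≢i')
  ... | yes refl = Linked-within {G} {H} (s i) (tLinked (x≢y ∘ cong (i ,_)))

DP-OrientedClique : ∀ n → OrientedClique (DP (3 + n)) 3
DP-OrientedClique n = (_↑ˡ n) , linked _ _
  where
  linked : ∀ i j → i ≢ j → Linked (DP (3 + n)) (i ↑ˡ n) (j ↑ˡ n)
  linked fzero               (fsuc fzero)        _ = inj₁ (inj₁ refl)
  linked fzero               (fsuc (fsuc fzero)) _ = inj₁ (inj₂ (fsuc fzero , refl , refl))
  linked (fsuc fzero)        fzero               _ = inj₂ (inj₁ refl)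
  linked (fsuc fzero)        (fsuc (fsuc fzero)) _ = inj₁ (inj₁ refl)
  linked (fsuc (fsuc fzero)) fzero               _ = inj₂ (inj₂ (fsuc fzero , refl , refl))
  linked (fsuc (fsuc fzero)) (fsuc fzero)        _ = inj₂ (inj₁ refl)
  linked fzero               fzero               i≢i = contradiction refl i≢i
  linked (fsuc fzero)        (fsuc fzero)        i≢i = contradiction refl i≢i
  linked (fsuc (fsuc fzero)) (fsuc (fsuc fzero)) i≢i = contradiction refl i≢i

rotate : Fin 3 → Fin 3
rotate fzero               = fsuc fzero
rotate (fsuc fzero)        = fsuc (fsuc fzero)
rotate (fsuc (fsuc fzero)) = fzero

C₃ : Digraph
C₃ = record { order = 3 ; Arc = λ i j → j ≡ rotate i }

C₃-oriented : IsOriented C₃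
C₃-oriented = irr , asym
  where
  irr : ∀ i → ¬ i ≡ rotate i
  irr fzero               ()
  irr (fsuc fzero)        ()
  irr (fsuc (fsuc fzero)) ()

  asym : ∀ i j → j ≡ rotate i → ¬ i ≡ rotate j
  asym fzero               _ refl ()
  asym (fsuc fzero)        _ refl ()
  asym (fsuc (fsuc fzero)) _ refl ()

position-mod3 : ℕ → Fin 3
position-mod3 zero    = fzero
position-mod3 (suc n) = rotate (position-mod3 n)

DP-hom-C₃ : ∀ k → Hom (DP k) C₃
DP-hom-C₃ k = position-mod3 ∘ toℕ , λ _ _ e → cong position-mod3 (sym e)

Lex-DP-Colourable-9 : ∀ k ℓ → Colourable (Lex (DP k) (DP ℓ)) 9
Lex-DP-Colourable-9 k ℓ =
  record { graph = Lex C₃ C₃ ; oriented = Lex-oriented C₃-oriented C₃-oriented } ,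
  refl , Lex-hom {DP k} {C₃} {DP ℓ} {C₃} (DP-hom-C₃ k) (DP-hom-C₃ ℓ)

theorem5 : (k ℓ : ℕ) → 3 ≤ k → 3 ≤ ℓ →
    OrientedChromaticNumber (Lex (DP k) (DP ℓ)) 9
theorem5 k@(suc (suc (suc a))) ℓ@(suc (suc (suc b))) (s≤s (s≤s (s≤s _))) (s≤s (s≤s (s≤s _))) =
  Lex-DP-Colourable-9 k ℓ ,
  λ _ → OrientedClique⇒¬Colourable {Lex (DP k) (DP ℓ)}
          (Lex-OrientedClique {DP k} {DP ℓ} (DP-OrientedClique a) (DP-OrientedClique b))
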